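{- For any connected digraph $D$ of order $n\ge3$, $L^t_2(D)+L^t_2(D^{ -1})\le\frac{16n}{9}$. This bound is sharp (attained by some connected digraphs).
   Context: Digraphs are finite, without loops or multiple arcs (opposite arcs allowed); connected means the underlying graph is connected. $D^{ -1}$ is the converse of $D$, obtained by reversing every arc. A vertex $u$ is adjacent with $v$ if $(u,v)$ or $(v,u)$ is an arc. A total $2$-limited packing is a set $B\subseteq V(D)$ such that every vertex in $B$ is adjacent with at most one vertex of $B$ and every vertex in $V(D)\setminus B$ has at most two out-neighbours in $B$; $L^t_2(D)$ is its maximum size. -}

module Defs where

open import Data.Nat using (ℕ; zero; suc; _≤_)
open import Data.Bool using (Bool; true; false; _∨_; _∧_; T)
open import Data.Fin using (Fin)
open import Data.Fin.Subset using (Subset; _∈_; _∉_; ∣_∣; _∩_)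
open import Data.Vec using (tabulate)
open import Relation.Binary.PropositionalEquality using (_≡_)

-- A digraph of order n on vertex set Fin n: arc u v = true iff (u,v) is an arc.
-- No loops; no multiple arcs (a relation); opposite arcs allowed.
record Digraph (n : ℕ) : Set where
  field
    arc   : Fin n → Fin n → Bool
    loopless : ∀ v → arc v v ≡ false
open Digraph public

converse : ∀ {n} → Digraph n → Digraph n
converse D = record { arc = λ u v → arc D v u ; loopless = loopless D }

adj : ∀ {n} → Digraph n → Fin n → Fin n → Bool
adj D u v = arc D u v ∨ arc D v u

data Walk {n} (D : Digraph n) : Fin n → Fin n → Set where
  here : ∀ {v} → Walk D v v
  step : ∀ {u w v} → T (adj D u w) → Walk D w v → Walk D u v

Connected : ∀ {n} → Digraph n → Set
Connected D = ∀ u v → Walk D u v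

Nbr : ∀ {n} → Digraph n → Fin n → Subset n
Nbr D v = tabulate (λ u → adj D v u)

OutNbr : ∀ {n} → Digraph n → Fin n → Subset n
OutNbr D v = tabulate (λ u → arc D v u)

IsTotal2LimitedPacking : ∀ {n} → Digraph n → Subset n → Set
IsTotal2LimitedPacking D B =
  (∀ v → v ∈ B → ∣ Nbr D v ∩ B ∣ ≤ 1) ×' (∀ v → v ∉ B → ∣ OutNbr D v ∩ B ∣ ≤ 2)
  where
    open import Data.Product using () renaming (_×_ to _×'_)

IsLt2 : ∀ {n} → Digraph n → ℕ → Set
IsLt2 D k = (Σ' (Subset _) λ B → IsTotal2LimitedPacking D B ×' ∣ B ∣ ≡ k)
          ×' (∀ B → IsTotal2LimitedPacking D B → ∣ B ∣ ≤ k)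
  where
    open import Data.Product using () renaming (_×_ to _×'_; Σ to Σ')

-- Let B be a total 2-limited packing of D, C one of D⁻¹ and S = B ∩ C. Give a vertex
-- capacity 0, 1 or 4 according as it lies in both, exactly one or neither of B and C;
-- a vertex z ∉ S has at most that many neighbours in S (a vertex of B has at most one
-- neighbour in B, a vertex outside B at most two out-neighbours in B, and dually for C).
-- As 9([z ∈ B] + [z ∈ C]) + 4·cap z ≤ 16 + 2[z ∈ S] for every z, it suffices to show
-- |S| ≤ 2·Σ cap. The boundary of S (vertices with a neighbour outside S) has at most
-- Σ cap elements by double counting the edges leaving S. An interior vertex of S has
-- all its neighbours in S ⊆ B, so at most one; since D is connected of order ≥ 3, it
-- has a boundary neighbour, and no boundary vertex serves two interior ones.
module Submission where

open import Defs
open import Data.Nat using (ℕ; zero; suc; _≤_; _≤?_; _+_; _*_; z≤n; s≤s)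
open import Data.Nat.Properties
  using (≤-refl; <-irrefl; ≤-reflexive; ≤-trans; +-mono-≤; +-monoʳ-≤; *-monoʳ-≤; m≤m+n; m≤n+m;
         +-identityʳ; +-comm; *-assoc; +-cancelʳ-≤; *-cancelˡ-≤; ≤ᵇ⇒≤; +-*-semiring; module ≤-Reasoning)
open import Data.Bool using (Bool; true; false; not; _∧_; _∨_; T)
open import Data.Bool.Properties using (T-∧; T-∨; T-≡; ∨-comm) renaming (_≟_ to _≟ᵇ_)
open import Data.Fin using (Fin; zero; suc)
open import Data.Fin.Patterns using (0F; 1F; 2F; 3F; 4F; 5F; 6F; 7F; 8F)
open import Data.Fin.Properties using (any?; all?)
open import Data.Fin.Subset using (Subset; ∣_∣; _∩_)
open import Data.Fin.Subset.Properties using (_∈?_)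
open import Data.Vec using ([]; _∷_; lookup; tabulate)
open import Data.Vec.Properties using (lookup-zipWith; lookup∘tabulate; []=⇒lookup; lookup⇒[]=)
open import Data.Product using (_×_; _,_; Σ; ∃; proj₁; proj₂)
open import Data.Sum using (_⊎_; inj₁; inj₂)
open import Data.Empty using (⊥; ⊥-elim)
open import Data.Unit using (tt)
open import Function using (_∘_; id)
open import Function.Bundles using (Equivalence)
open import Relation.Nullary using (¬_; yes; no; contradiction)
open import Relation.Nullary.Decidable
  using (Dec; ⌊_⌋; T?; toWitness; fromWitness; decidable-stable; _×-dec_; _→-dec_; ¬?)
open import Relation.Binary.PropositionalEquality
  using (_≡_; refl; sym; trans; cong; cong₂; subst)
open import Algebra.Properties.Semiring.Sum +-*-semiring
  using (sum; sum-cong-≗; ∑-distrib-+; ∑-comm; *-distribˡ-sum)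

open Equivalence using (to; from)

𝟙 : Bool → ℕ
𝟙 true  = 1
𝟙 false = 0

count : ∀ {n} → (Fin n → Bool) → ℕ
count P = sum (λ i → 𝟙 (P i))

T-∧-intro : ∀ {a b} → T a → T b → T (a ∧ b)
T-∧-intro p q = from T-∧ (p , q)

T-∧-elim : ∀ a {b} → T (a ∧ b) → T a × T b
T-∧-elim a = to (T-∧ {a})

¬T⇒T-not : ∀ {b} → ¬ T b → T (not b)
¬T⇒T-not {false} _  = tt
¬T⇒T-not {true}  ¬b = ¬b tt

T-not⇒¬T : ∀ {b} → T (not b) → ¬ T b
T-not⇒¬T {false} _ ()

T-∨-∧ : ∀ p q {b c} → T (p ∨ q) → T b → T c → T ((q ∧ b) ∨ (p ∧ c))
T-∨-∧ true  q     _ _  tc = from (T-∨ {q ∧ _}) (inj₂ tc)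
T-∨-∧ false true  _ tb _  = from T-∨ (inj₁ tb)

sum-mono-≤ : ∀ {n} {f g : Fin n → ℕ} → (∀ i → f i ≤ g i) → sum f ≤ sum g
sum-mono-≤ {zero}  f≤g = z≤n
sum-mono-≤ {suc n} f≤g = +-mono-≤ (f≤g zero) (sum-mono-≤ (f≤g ∘ suc))

≤-sum : ∀ {n} (f : Fin n → ℕ) i → f i ≤ sum f
≤-sum f zero    = m≤m+n (f zero) _
≤-sum f (suc i) = ≤-trans (≤-sum (f ∘ suc) i) (m≤n+m _ (f zero))

sum-linear : ∀ {n} a b (f g : Fin n → ℕ) →
             sum (λ i → a * f i + b * g i) ≡ a * sum f + b * sum g
sum-linear a b f g =
  trans (∑-distrib-+ (λ i → a * f i) (λ i → b * g i))
        (sym (cong₂ _+_ (*-distribˡ-sum a f) (*-distribˡ-sum b g)))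

count-true : ∀ n → count {n} (λ _ → true) ≡ n
count-true zero    = refl
count-true (suc n) = cong suc (count-true n)

count-false : ∀ n → count {n} (λ _ → false) ≡ 0
count-false zero    = refl
count-false (suc n) = count-false n

𝟙-mono : ∀ {a b} → (T a → T b) → 𝟙 a ≤ 𝟙 b
𝟙-mono {false}         _   = z≤n
𝟙-mono {true} {true}   _   = ≤-refl
𝟙-mono {true} {false} a⇒b = ⊥-elim (a⇒b tt)

count-mono : ∀ {n} {P Q : Fin n → Bool} → (∀ i → T (P i) → T (Q i)) → count P ≤ count Q
count-mono P⇒Q = sum-mono-≤ (λ i → 𝟙-mono (P⇒Q i))

T⇒1≤count : ∀ {n} {P : Fin n → Bool} {i} → T (P i) → 1 ≤ count P
T⇒1≤count {P = P} {i} p = ≤-trans (𝟙-mono {true} (λ _ → p)) (≤-sum (𝟙 ∘ P) i)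

count-∨ : ∀ {n} (P Q : Fin n → Bool) → count (λ i → P i ∨ Q i) ≤ count P + count Q
count-∨ P Q =
  ≤-trans (sum-mono-≤ (λ i → 𝟙-∨ (P i) (Q i))) (≤-reflexive (∑-distrib-+ (𝟙 ∘ P) (𝟙 ∘ Q)))
  where
    𝟙-∨ : ∀ a b → 𝟙 (a ∨ b) ≤ 𝟙 a + 𝟙 b
    𝟙-∨ true  b = m≤m+n 1 (𝟙 b)
    𝟙-∨ false b = ≤-refl

count-split : ∀ {n} (P Q : Fin n → Bool) →
              count P ≤ count (λ i → P i ∧ Q i) + count (λ i → P i ∧ not (Q i))
count-split P Q = ≤-trans (count-mono (λ i → cases (P i) (Q i)))
                          (count-∨ (λ i → P i ∧ Q i) (λ i → P i ∧ not (Q i)))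
  where
    cases : ∀ a b → T a → T ((a ∧ b) ∨ (a ∧ not b))
    cases true true  _ = tt
    cases true false _ = tt

count≤1⇒unique : ∀ {n} {P : Fin n → Bool} → count P ≤ 1 →
                 ∀ {i j} → T (P i) → T (P j) → i ≡ j
count≤1⇒unique               le {zero}  {zero}  _ _ = refl
count≤1⇒unique {P = P} le {zero}  {suc j} p q =
  ⊥-elim (<-irrefl refl (≤-trans (+-mono-≤ (𝟙-mono {true} (λ _ → p)) (T⇒1≤count {P = P ∘ suc} q)) le))
count≤1⇒unique {P = P} le {suc i} {zero}  p q =
  sym (count≤1⇒unique {P = P} le {zero} {suc i} q p)
count≤1⇒unique {P = P} le {suc i} {suc j} p q =
  cong suc (count≤1⇒unique {P = P ∘ suc} (≤-trans (m≤n+m _ (𝟙 (P zero))) le) p q)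

count≤𝟙 : ∀ {n} {P : Fin n → Bool} {b} → (∀ i → T (P i) → T b) → (T b → count P ≤ 1) →
          count P ≤ 𝟙 b
count≤𝟙 {b = true}  _   ≤1 = ≤1 tt
count≤𝟙 {n} {b = false} P⇒b _ = ≤-trans (count-mono P⇒b) (≤-reflexive (count-false n))

double-count : ∀ {m n} (P : Fin m → Bool) (R : Fin m → Fin n → Bool) (k : Fin n → ℕ) →
               (∀ x → T (P x) → ∃ λ y → T (R x y)) →
               (∀ y → count (λ x → P x ∧ R x y) ≤ k y) →
               count P ≤ sum k
double-count P R k partner bound = begin
  count P                                    ≤⟨ sum-mono-≤ (λ x → 𝟙≤count (P x) (partner x)) ⟩
  sum (λ x → count (λ y → P x ∧ R x y))      ≡⟨ ∑-comm (λ x y → 𝟙 (P x ∧ R x y)) ⟩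
  sum (λ y → count (λ x → P x ∧ R x y))      ≤⟨ sum-mono-≤ bound ⟩
  sum k                                      ∎
  where
    open ≤-Reasoning
    𝟙≤count : ∀ {n} b {Q : Fin n → Bool} → (T b → ∃ λ y → T (Q y)) → 𝟙 b ≤ count (λ y → b ∧ Q y)
    𝟙≤count false _       = z≤n
    𝟙≤count true {Q} partner = T⇒1≤count {P = Q} (proj₂ (partner tt))

∣p∣≡count : ∀ {n} (p : Subset n) → ∣ p ∣ ≡ count (lookup p)
∣p∣≡count []          = refl
∣p∣≡count (true ∷ p)  = cong suc (∣p∣≡count p)
∣p∣≡count (false ∷ p) = ∣p∣≡count p

∣tabulate∩p∣≡count : ∀ {n} (g : Fin n → Bool) (p : Subset n) →
                     ∣ tabulate g ∩ p ∣ ≡ count (λ i → g i ∧ lookup p i)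
∣tabulate∩p∣≡count g p = trans (∣p∣≡count (tabulate g ∩ p)) (sum-cong-≗ λ i →
  cong 𝟙 (trans (lookup-zipWith _∧_ i (tabulate g) p) (cong (_∧ lookup p i) (lookup∘tabulate g i))))

adj-sym : ∀ {n} (D : Digraph n) {u v} → T (adj D u v) → T (adj D v u)
adj-sym D {u} {v} = subst T (∨-comm (arc D u v) (arc D v u))

module _ {n} {D : Digraph n} where

  _++ʷ_ : ∀ {u v w} → Walk D u v → Walk D v w → Walk D u w
  here       ++ʷ q = q
  step t p   ++ʷ q = step t (p ++ʷ q)

  reverseʷ : ∀ {u v} → Walk D u v → Walk D v u
  reverseʷ here       = here
  reverseʷ (step t p) = reverseʷ p ++ʷ step (adj-sym D t) here

  rooted⇒connected : ∀ {r} → (∀ v → Walk D v r) → Connected D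
  rooted⇒connected to-r u v = to-r u ++ʷ reverseʷ (to-r v)

  walk-preserves : (K : Fin n → Set) → (∀ {a b} → T (adj D a b) → K a → K b) →
                   ∀ {u v} → Walk D u v → K u → K v
  walk-preserves K closed here       = id
  walk-preserves K closed (step t p) = walk-preserves K closed p ∘ closed t

¬point∪subsingleton-covers : ∀ {n} → 3 ≤ n → (x : Fin n) (P : Fin n → Set) →
                             (∀ {u v} → P u → P v → u ≡ v) → ¬ (∀ v → v ≡ x ⊎ P v)
¬point∪subsingleton-covers (s≤s (s≤s (s≤s _))) x P unique cover
  with cover 0F | cover 1F | cover 2F
... | inj₁ refl | inj₁ ()   | _
... | inj₁ refl | inj₂ p₁   | inj₁ ()
... | inj₁ refl | inj₂ p₁   | inj₂ p₂ = contradiction (unique p₁ p₂) λ ()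
... | inj₂ p₀   | inj₁ refl | inj₁ ()
... | inj₂ p₀   | inj₁ refl | inj₂ p₂ = contradiction (unique p₀ p₂) λ ()
... | inj₂ p₀   | inj₂ p₁   | _       = contradiction (unique p₀ p₁) λ ()

no-component-of-order≤2 : ∀ {n} {D : Digraph n} → 3 ≤ n → Connected D → ∀ x →
                          (∀ {u v} → T (adj D x u) → T (adj D x v) → u ≡ v) →
                          (∀ {u w} → T (adj D x u) → T (adj D u w) → w ≡ x) → ⊥
no-component-of-order≤2 {D = D} n≥3 connected x unique back =
  ¬point∪subsingleton-covers n≥3 x (T ∘ adj D x) unique
    (λ v → walk-preserves K closed (connected x v) (inj₁ refl))
  where
    K : _ → Set
    K v = v ≡ x ⊎ T (adj D x v)
    closed : ∀ {a b} → T (adj D a b) → K a → K b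
    closed t (inj₁ refl) = inj₂ t
    closed t (inj₂ xa)   = inj₁ (back xa t)

module _ {n} (D : Digraph n) {B : Subset n} (packing : IsTotal2LimitedPacking D B) where

  packing-nbr : ∀ {v} → T (lookup B v) → count (λ u → adj D v u ∧ lookup B u) ≤ 1
  packing-nbr {v} v∈B = subst (_≤ 1) (∣tabulate∩p∣≡count (adj D v) B)
    (proj₁ packing v (lookup⇒[]= v B (to T-≡ v∈B)))

  packing-out : ∀ {v} → ¬ T (lookup B v) → count (λ u → arc D v u ∧ lookup B u) ≤ 2
  packing-out {v} v∉B = subst (_≤ 2) (∣tabulate∩p∣≡count (arc D v) B)
    (proj₂ packing v (λ v∈B → v∉B (from T-≡ ([]=⇒lookup v∈B))))

packing? : ∀ {n} (D : Digraph n) B → Dec (IsTotal2LimitedPacking D B)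
packing? D B = all? (λ v → v ∈? B →-dec ∣ Nbr D v ∩ B ∣ ≤? 1)
         ×-dec all? (λ v → ¬? (v ∈? B) →-dec ∣ OutNbr D v ∩ B ∣ ≤? 2)

capacity : Bool → Bool → ℕ
capacity true  true  = 0
capacity true  false = 1
capacity false true  = 1
capacity false false = 4

weight-bound : ∀ b c → 9 * (𝟙 b + 𝟙 c) + 4 * capacity b c ≤ 16 + 2 * 𝟙 (b ∧ c)
weight-bound true  true  = ≤ᵇ⇒≤ 18 18 tt
weight-bound true  false = ≤ᵇ⇒≤ 13 16 tt
weight-bound false true  = ≤ᵇ⇒≤ 13 16 tt
weight-bound false false = ≤ᵇ⇒≤ 16 16 tt

module PackingPair {n} {D : Digraph n} (n≥3 : 3 ≤ n) (connected : Connected D)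
  {B C : Subset n} (packB : IsTotal2LimitedPacking D B)
  (packC : IsTotal2LimitedPacking (converse D) C) where

  inB inC inS : Fin n → Bool
  inB = lookup B
  inC = lookup C
  inS v = inB v ∧ inC v

  exposed? : ∀ v → Dec (∃ λ u → T (adj D v u ∧ not (inS u)))
  exposed? v = any? λ u → T? (adj D v u ∧ not (inS u))

  exposed : Fin n → Bool
  exposed v = ⌊ exposed? v ⌋

  W : ℕ
  W = sum (λ v → capacity (inB v) (inC v))

  S⇒B : ∀ {v} → T (inS v) → T (inB v)
  S⇒B {v} = proj₁ ∘ T-∧-elim (inB v)

  S⇒C : ∀ {v} → T (inS v) → T (inC v)
  S⇒C {v} = proj₂ ∘ T-∧-elim (inB v)

  unexposed⇒nbr∈S : ∀ {x u} → ¬ T (exposed x) → T (adj D x u) → T (inS u)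
  unexposed⇒nbr∈S {x} {u} ¬ex t =
    decidable-stable (T? (inS u)) λ u∉S →
      ¬ex (fromWitness {a? = exposed? x} (u , T-∧-intro t (¬T⇒T-not u∉S)))

  nbr∈B : ∀ {x u} → T (inS x) → T (adj D u x) → T (adj D u x ∧ inB x)
  nbr∈B x∈S t = T-∧-intro t (S⇒B x∈S)

  boundary interior : Fin n → Bool
  boundary x = inS x ∧ exposed x
  interior x = inS x ∧ not (exposed x)

  interior-has-boundary-nbr : ∀ {x} → T (interior x) → ∃ λ y → T (adj D x y ∧ boundary y)
  interior-has-boundary-nbr {x} x∈S° with T-∧-elim (inS x) x∈S°
  ... | x∈S , x-unexposed with any? (λ y → T? (adj D x y ∧ boundary y))
  ...   | yes found = found
  ...   | no none   = ⊥-elim (no-component-of-order≤2 n≥3 connected x unique back)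
    where
      ¬ex = T-not⇒¬T x-unexposed
      unique : ∀ {u v} → T (adj D x u) → T (adj D x v) → u ≡ v
      unique tu tv = count≤1⇒unique (packing-nbr D packB (S⇒B x∈S))
        (nbr∈B (unexposed⇒nbr∈S ¬ex tu) tu) (nbr∈B (unexposed⇒nbr∈S ¬ex tv) tv)
      back : ∀ {u w} → T (adj D x u) → T (adj D u w) → w ≡ x
      back {u} tu tw = count≤1⇒unique (packing-nbr D packB (S⇒B u∈S))
          (nbr∈B (unexposed⇒nbr∈S ¬eu tw) tw) (nbr∈B x∈S (adj-sym D tu))
        where
          u∈S = unexposed⇒nbr∈S ¬ex tu
          ¬eu : ¬ T (exposed u)
          ¬eu eu = none (u , T-∧-intro tu (T-∧-intro u∈S eu))

  interior≤boundary : count interior ≤ count boundary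
  interior≤boundary =
    double-count interior (λ x y → adj D x y ∧ boundary y) _ (λ _ → interior-has-boundary-nbr) bound
    where
      bound : ∀ y → count (λ x → interior x ∧ (adj D x y ∧ boundary y)) ≤ 𝟙 (boundary y)
      bound y = count≤𝟙 y∈∂S λ y∈∂S →
        ≤-trans (count-mono B-nbr) (packing-nbr D packB (S⇒B (proj₁ (T-∧-elim (inS y) y∈∂S))))
        where
          R : Fin n → Bool
          R x = interior x ∧ (adj D x y ∧ boundary y)
          y∈∂S : ∀ x → T (R x) → T (boundary y)
          y∈∂S x = proj₂ ∘ T-∧-elim (adj D x y) ∘ proj₂ ∘ T-∧-elim (interior x)
          B-nbr : ∀ x → T (R x) → T (adj D y x ∧ inB x)
          B-nbr x t with T-∧-elim (interior x) t
          ... | x∈S° , x~y∈∂S =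
            nbr∈B (proj₁ (T-∧-elim (inS x) x∈S°)) (adj-sym D (proj₁ (T-∧-elim (adj D x y) x~y∈∂S)))

  cut-edge : Fin n → Fin n → Bool
  cut-edge x z = inS x ∧ (adj D x z ∧ not (inS z))

  cut-edge-src : ∀ {x z} → T (cut-edge x z) → T (inS x)
  cut-edge-src {x} = proj₁ ∘ T-∧-elim (inS x)

  cut-edge-adj : ∀ {x z} → T (cut-edge x z) → T (adj D x z)
  cut-edge-adj {x} {z} = proj₁ ∘ T-∧-elim (adj D x z) ∘ proj₂ ∘ T-∧-elim (inS x)

  cut-edge-tgt : ∀ {x z} → T (cut-edge x z) → ¬ T (inS z)
  cut-edge-tgt {x} {z} = T-not⇒¬T ∘ proj₂ ∘ T-∧-elim (adj D x z) ∘ proj₂ ∘ T-∧-elim (inS x)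

  cut-edges≤capacity : ∀ z → count (λ x → cut-edge x z) ≤ capacity (inB z) (inC z)
  cut-edges≤capacity z = go (inB z) (inC z) refl refl
    where
      mono : ∀ Q → (∀ x → T (cut-edge x z) → T (Q x)) → count (λ x → cut-edge x z) ≤ count Q
      mono Q = count-mono
      go : ∀ b c → inB z ≡ b → inC z ≡ c → count (λ x → cut-edge x z) ≤ capacity b c
      go true  true  z∈B z∈C = ≤-trans
        (mono (λ _ → false) λ x e → cut-edge-tgt e (T-∧-intro (from T-≡ z∈B) (from T-≡ z∈C)))
        (≤-reflexive (count-false n))
      go true  false z∈B _   = ≤-trans
        (mono (λ x → adj D z x ∧ inB x) λ x e → T-∧-intro (adj-sym D (cut-edge-adj e)) (S⇒B (cut-edge-src e)))
        (packing-nbr D packB (from T-≡ z∈B))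
      go false true  _   z∈C = ≤-trans
        (mono (λ x → adj D x z ∧ inC x) λ x e → T-∧-intro (cut-edge-adj e) (S⇒C (cut-edge-src e)))
        (packing-nbr (converse D) packC (from T-≡ z∈C))
      go false false z∉B z∉C = ≤-trans
        (mono (λ x → (arc D z x ∧ inB x) ∨ (arc D x z ∧ inC x)) λ x e →
          T-∨-∧ (arc D x z) (arc D z x) (cut-edge-adj e) (S⇒B (cut-edge-src e)) (S⇒C (cut-edge-src e)))
        (≤-trans (count-∨ (λ x → arc D z x ∧ inB x) (λ x → arc D x z ∧ inC x))
                 (+-mono-≤ (packing-out D packB (subst T z∉B))
                           (packing-out (converse D) packC (subst T z∉C))))

  boundary≤W : count boundary ≤ W
  boundary≤W = double-count boundary cut-edge _ partner λ z →
    ≤-trans (count-mono {P = λ x → boundary x ∧ cut-edge x z} {Q = λ x → cut-edge x z}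
                        λ x → proj₂ ∘ T-∧-elim (boundary x))
            (cut-edges≤capacity z)
    where
      partner : ∀ x → T (boundary x) → ∃ λ z → T (cut-edge x z)
      partner x t with T-∧-elim (inS x) t
      ... | x∈S , ex with toWitness {a? = exposed? x} ex
      ...   | z , e = z , T-∧-intro x∈S e

  |S|≤2W : count inS ≤ 2 * W
  |S|≤2W = begin
    count inS                         ≤⟨ count-split inS exposed ⟩
    count boundary + count interior   ≤⟨ +-monoʳ-≤ (count boundary) interior≤boundary ⟩
    count boundary + count boundary   ≤⟨ +-mono-≤ boundary≤W boundary≤W ⟩
    W + W                             ≡⟨ cong (W +_) (+-identityʳ W) ⟨
    2 * W                             ∎
    where open ≤-Reasoning

  packings-bound : 9 * (∣ B ∣ + ∣ C ∣) ≤ 16 * n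
  packings-bound = +-cancelʳ-≤ (4 * W) _ _ (begin
    9 * (∣ B ∣ + ∣ C ∣) + 4 * W
      ≡⟨ cong (λ k → 9 * k + 4 * W) ∣B∣+∣C∣≡sum ⟩
    9 * sum (λ v → 𝟙 (inB v) + 𝟙 (inC v)) + 4 * W
      ≡⟨ sum-linear 9 4 (λ v → 𝟙 (inB v) + 𝟙 (inC v)) (λ v → capacity (inB v) (inC v)) ⟨
    sum (λ v → 9 * (𝟙 (inB v) + 𝟙 (inC v)) + 4 * capacity (inB v) (inC v))
      ≤⟨ sum-mono-≤ (λ v → weight-bound (inB v) (inC v)) ⟩
    sum (λ v → 16 * 1 + 2 * 𝟙 (inS v))
      ≡⟨ sum-linear 16 2 (λ _ → 1) (𝟙 ∘ inS) ⟩
    16 * count {n} (λ _ → true) + 2 * count inS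
      ≡⟨ cong (λ k → 16 * k + 2 * count inS) (count-true n) ⟩
    16 * n + 2 * count inS
      ≤⟨ +-monoʳ-≤ (16 * n) (*-monoʳ-≤ 2 |S|≤2W) ⟩
    16 * n + 2 * (2 * W)
      ≡⟨ cong (16 * n +_) (*-assoc 2 2 W) ⟨
    16 * n + 4 * W ∎)
    where
      open ≤-Reasoning
      ∣B∣+∣C∣≡sum : ∣ B ∣ + ∣ C ∣ ≡ sum (λ v → 𝟙 (inB v) + 𝟙 (inC v))
      ∣B∣+∣C∣≡sum = trans (cong₂ _+_ (∣p∣≡count B) (∣p∣≡count C)) (sym (∑-distrib-+ (𝟙 ∘ inB) (𝟙 ∘ inC)))

-- The eight non-central vertices form a packing of both E and E⁻¹, and the
-- bound itself shows that no packing is larger.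
star : Fin 9 → Fin 9 → Bool
star 0F 1F = true
star 0F 3F = true
star 5F 0F = true
star 7F 0F = true
star 1F 2F = true
star 3F 4F = true
star 5F 6F = true
star 7F 8F = true
star _  _  = false

E : Digraph 9
E = record { arc = star ; loopless = toWitness {a? = all? λ v → star v v ≟ᵇ false} tt }

to-centre : ∀ v → Walk E v 0F
to-centre 0F = here
to-centre 1F = step tt here
to-centre 2F = step {w = 1F} tt (step tt here)
to-centre 3F = step tt here
to-centre 4F = step {w = 3F} tt (step tt here)
to-centre 5F = step tt here
to-centre 6F = step {w = 5F} tt (step tt here)
to-centre 7F = step tt here
to-centre 8F = step {w = 7F} tt (step tt here)

E-connected : Connected E
E-connected = rooted⇒connected to-centre

non-centre : Subset 9
non-centre = false ∷ true ∷ true ∷ true ∷ true ∷ true ∷ true ∷ true ∷ true ∷ []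

E-packing : IsTotal2LimitedPacking E non-centre
E-packing = toWitness {a? = packing? E non-centre} tt

E⁻¹-packing : IsTotal2LimitedPacking (converse E) non-centre
E⁻¹-packing = toWitness {a? = packing? (converse E) non-centre} tt

3≤9 : 3 ≤ 9
3≤9 = ≤ᵇ⇒≤ 3 9 tt

size≤8 : ∀ m → 9 * (m + 8) ≤ 16 * 9 → m ≤ 8
size≤8 m le = +-cancelʳ-≤ 8 m 8 (*-cancelˡ-≤ 9 le)

Lt2-E : IsLt2 E 8
Lt2-E = (non-centre , E-packing , refl) , λ B packB →
  size≤8 ∣ B ∣ (PackingPair.packings-bound 3≤9 E-connected packB E⁻¹-packing)

Lt2-E⁻¹ : IsLt2 (converse E) 8
Lt2-E⁻¹ = (non-centre , E⁻¹-packing , refl) , λ C packC →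
  size≤8 ∣ C ∣ (subst (λ k → 9 * k ≤ 16 * 9) (+-comm 8 ∣ C ∣)
    (PackingPair.packings-bound 3≤9 E-connected E-packing packC))

theorem6 : (∀ (n : ℕ) (D : Digraph n) → 3 ≤ n → Connected D →
               ∀ k l → IsLt2 D k → IsLt2 (converse D) l → 9 * (k + l) ≤ 16 * n)
             × (Σ ℕ λ n → Σ (Digraph n) λ D → 3 ≤ n × Connected D ×
               Σ ℕ λ k → Σ ℕ λ l → IsLt2 D k × IsLt2 (converse D) l × 9 * (k + l) ≡ 16 * n)
theorem6 = upper , (9 , E , 3≤9 , E-connected , 8 , 8 , Lt2-E , Lt2-E⁻¹ , refl)
  where
    upper : ∀ (n : ℕ) (D : Digraph n) → 3 ≤ n → Connected D →
            ∀ k l → IsLt2 D k → IsLt2 (converse D) l → 9 * (k + l) ≤ 16 * n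
    upper n D n≥3 connected _ _ ((B , packB , refl) , _) ((C , packC , refl) , _) =
      PackingPair.packings-bound n≥3 connected packB packC
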